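{- Let $O$ be a locally finite totally ordered set. An element $A\ne1$ of $\mathscr E_O$ is $\wedge$-irreducible if and only if $A=\widetilde I$ for some interval $I\in\mathscr I^\infty_O$.
   Context: An interval of $O$ is a convex subset (including $\emptyset$ and $O$); $\mathscr I_O$ is the set of finite intervals, $\mathscr I^\infty_O$ the set of all intervals. $\mathscr E_O$ is the set of inclusion-antichains of elements of $\mathscr I_O$, ordered by $A\le B$ iff for every $I\in A$ there is $J\in B$ with $J\subseteq I$; its top is $1=\{\emptyset\}$. For $I\in\mathscr I^\infty_O$, $\widetilde I=\{\{x\}: x\in O\setminus I\}$. An element $x$ of a lattice is $\wedge$-irreducible if $x=a\wedge b$ implies $x=a$ or $x=b$. -}

module Defs where

open import Level using (Level)
open import Data.Product using (Σ; ∃; _×_; _,_)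
open import Data.Sum using (_⊎_)
open import Data.Empty using (⊥)
open import Data.List using (List)
open import Data.List.Membership.Propositional using (_∈_)
open import Relation.Nullary using (¬_)
open import Relation.Binary.PropositionalEquality using (_≡_)

Subset : Set → Set₁
Subset O = O → Set

module _ {O : Set} where

  _⊆_ : Subset O → Subset O → Set
  I ⊆ J = ∀ x → I x → J x

  _≐_ : Subset O → Subset O → Set
  I ≐ J = I ⊆ J × J ⊆ I

  ∅ : Subset O
  ∅ _ = ⊥

  ｛_｝ : O → Subset O
  ｛ x ｝ y = x ≡ y

  Finite : Subset O → Set
  Finite I = Σ (List O) λ xs → ∀ x → I x → x ∈ xs

  Interval : (O → O → Set) → Subset O → Set
  Interval _≤_ I = ∀ x y z → I x → I z → x ≤ y → y ≤ z → I y

  FinInterval : (O → O → Set) → Subset O → Set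
  FinInterval _≤_ I = Interval _≤_ I × Finite I

  LocallyFinite : (O → O → Set) → Set
  LocallyFinite _≤_ = ∀ a b → Finite (λ x → a ≤ x × x ≤ b)

  Family : Set₁
  Family = Subset O → Set

  -- A is an element of 𝓔_O: an inclusion-antichain of finite intervals
  -- (subsets equal up to ≐ are identified)
  IsE : (O → O → Set) → Family → Set₁
  IsE _≤_ A = (∀ I → A I → FinInterval _≤_ I)
            × (∀ I J → A I → A J → I ⊆ J → I ≐ J)

  _≤E_ : Family → Family → Set₁
  A ≤E B = ∀ I → A I → Σ (Subset O) λ J → B J × J ⊆ I

  _≈E_ : Family → Family → Set₁
  A ≈E B = (∀ I → A I → Σ (Subset O) λ J → B J × J ≐ I)
         × (∀ J → B J → Σ (Subset O) λ I → A I × I ≐ J)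

  𝟙 : Family
  𝟙 I = I ≐ ∅

  tilde : Subset O → Family
  tilde I J = Σ O λ x → ¬ I x × J ≐ ｛ x ｝

  IsMeet : (O → O → Set) → Family → Family → Family → Set₁
  IsMeet _≤_ A B C = IsE _≤_ C × C ≤E A × C ≤E B
    × (∀ D → IsE _≤_ D → D ≤E A → D ≤E B → D ≤E C)

  MeetIrreducible : (O → O → Set) → Family → Set₁
  MeetIrreducible _≤_ A = ∀ B C → IsE _≤_ B → IsE _≤_ C → IsMeet _≤_ B C A
    → (A ≈E B) ⊎ (A ≈E C)

-- If A = Ĩ and A = B ∧ C with A ≠ B, C, then B and C each have a member inside I
-- (otherwise they would coincide with A); the convex hull of the two is a finite interval
-- below B and C, hence it contains a member {x} of A, although x ∉ I.
-- Conversely, for ∧-irreducible A ≠ 1 let I be the union of the finite intervals containing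
-- no member of A. These intervals are closed under convex hulls: if the hull of J and K
-- contained a member of A, then A would be the meet of the two elements obtained by adjoining
-- J, resp. K, to A, and irreducibility fails. So I is an interval, a finite subset of I lies in
-- a single such interval, and hence every member of A is a singleton outside I; for x ∉ I the
-- interval {x} contains a member of A, which must be {x} itself.
module Submission where

open import Defs
open import Axiom.DoubleNegationElimination using (em⇒dne)
open import Axiom.ExcludedMiddle using (ExcludedMiddle)
open import Data.Empty using (⊥-elim)
open import Data.List using (List; []; _∷_; _++_; concatMap)
open import Data.List.Membership.Propositional using (_∈_; lose)
open import Data.List.Membership.Propositional.Properties using (∈-++⁺ˡ; ∈-++⁺ʳ; ∈-concatMap⁺)
open import Data.List.Relation.Unary.Any using (here; there)
open import Data.Product using (Σ; _×_; _,_; proj₁; proj₂)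
open import Data.Sum using (_⊎_; inj₁; inj₂; [_,_])
open import Function.Base using (_∘_)
open import Function.Bundles using (_⇔_; mk⇔)
open import Relation.Binary.Definitions using (Antisymmetric)
open import Relation.Binary.PropositionalEquality using (_≡_; refl; sym; subst)
open import Relation.Binary.Structures using (IsPreorder; IsPartialOrder; IsTotalOrder)
open import Relation.Nullary using (¬_; yes; no)
open import Relation.Nullary.Decidable using (True; toWitness; fromWitness)

module _ {O : Set} where

  ⊆-refl : {X : Subset O} → X ⊆ X
  ⊆-refl _ Xx = Xx

  ⊆-trans : {X Y Z : Subset O} → X ⊆ Y → Y ⊆ Z → X ⊆ Z
  ⊆-trans X⊆Y Y⊆Z x Xx = Y⊆Z x (X⊆Y x Xx)

  ≐-refl : {X : Subset O} → X ≐ X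
  ≐-refl = ⊆-refl , ⊆-refl

  ≐-sym : {X Y : Subset O} → X ≐ Y → Y ≐ X
  ≐-sym (X⊆Y , Y⊆X) = Y⊆X , X⊆Y

  ≐-trans : {X Y Z : Subset O} → X ≐ Y → Y ≐ Z → X ≐ Z
  ≐-trans (X⊆Y , Y⊆X) (Y⊆Z , Z⊆Y) = ⊆-trans X⊆Y Y⊆Z , ⊆-trans Z⊆Y Y⊆X

  ｛｝-⊆ : {X : Subset O} {x : O} → X x → ｛ x ｝ ⊆ X
  ｛｝-⊆ {X} Xx _ x≡y = subst X x≡y Xx

  ⊆∅ : {X Y : Subset O} → X ⊆ ∅ → X ⊆ Y
  ⊆∅ X⊆∅ x Xx = ⊥-elim (X⊆∅ x Xx)

  singletonFamily : Subset O → Family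
  singletonFamily X Y = Y ≐ X

  singletonFamily-≤E : {X J : Subset O} {B : Family} → B J → J ⊆ X → singletonFamily X ≤E B
  singletonFamily-≤E {J = J} BJ J⊆X Y (_ , X⊆Y) = J , BJ , ⊆-trans J⊆X X⊆Y

module _ {O : Set} {_≤_ : O → O → Set} where

  FinInterval-≐ : {X Y : Subset O} → X ≐ Y → FinInterval _≤_ Y → FinInterval _≤_ X
  FinInterval-≐ (X⊆Y , Y⊆X) (Y-interval , xs , Y⊆xs) =
    (λ x y z Xx Xz x≤y y≤z → Y⊆X y (Y-interval x y z (X⊆Y x Xx) (X⊆Y z Xz) x≤y y≤z)) ,
    xs , (λ x Xx → Y⊆xs x (X⊆Y x Xx))

  ∅-finInterval : FinInterval _≤_ ∅
  ∅-finInterval = (λ _ _ _ ()) , [] , λ _ ()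

  ｛｝-finInterval : Antisymmetric _≡_ _≤_ → (x : O) → FinInterval _≤_ ｛ x ｝
  ｛｝-finInterval antisym x =
    (λ { _ _ _ refl refl x≤y y≤x → antisym x≤y y≤x }) , (x ∷ []) , λ { _ refl → here refl }

  singletonFamily-IsE : {X : Subset O} → FinInterval _≤_ X → IsE _≤_ (singletonFamily X)
  singletonFamily-IsE X-fi =
    (λ Y Y≐X → FinInterval-≐ Y≐X X-fi) , (λ Y Z Y≐X Z≐X _ → ≐-trans Y≐X (≐-sym Z≐X))

  ∅∈⇒≈𝟙 : {A : Family} → IsE _≤_ A → {N : Subset O} → A N → N ⊆ ∅ → A ≈E 𝟙
  ∅∈⇒≈𝟙 (_ , antichain) {N} AN N⊆∅ =
    (λ M AM → M , (⊆-trans (proj₂ (antichain N M AN AM (⊆∅ N⊆∅))) N⊆∅ , λ _ ()) , ≐-refl) ,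
    (λ J (J⊆∅ , _) → N , AN , ⊆∅ N⊆∅ , ⊆∅ J⊆∅)

module Hull {O : Set} {_≤_ : O → O → Set} (isPreorder : IsPreorder _≡_ _≤_) where

  open IsPreorder isPreorder using (trans) renaming (refl to ≤-refl)

  hull : Subset O → Subset O → Subset O
  hull J K y = Σ O λ a → Σ O λ b → (J a ⊎ K a) × (J b ⊎ K b) × a ≤ y × y ≤ b

  ⊆-hullˡ : (J K : Subset O) → J ⊆ hull J K
  ⊆-hullˡ J K x Jx = x , x , inj₁ Jx , inj₁ Jx , ≤-refl , ≤-refl

  ⊆-hullʳ : (J K : Subset O) → K ⊆ hull J K
  ⊆-hullʳ J K x Kx = x , x , inj₂ Kx , inj₂ Kx , ≤-refl , ≤-refl

  hull-interval : (J K : Subset O) → Interval _≤_ (hull J K)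
  hull-interval J K x y z (a , _ , Ja , _ , a≤x , _) (_ , b , _ , Jb , _ , z≤b) x≤y y≤z =
    a , b , Ja , Jb , trans a≤x x≤y , trans y≤z z≤b

  hull-least : {J K X : Subset O} → Interval _≤_ X → J ⊆ X → K ⊆ X → hull J K ⊆ X
  hull-least {J} {K} {X} X-interval J⊆X K⊆X y (a , b , Ja , Jb , a≤y , y≤b) =
    X-interval a y b (∪⊆X a Ja) (∪⊆X b Jb) a≤y y≤b
    where
    ∪⊆X : ∀ c → J c ⊎ K c → X c
    ∪⊆X c = [ J⊆X c , K⊆X c ]

  hull-finite : LocallyFinite _≤_ → {J K : Subset O} → Finite J → Finite K → Finite (hull J K)
  hull-finite lf {J} {K} (xs , J⊆xs) (ys , K⊆ys) = concatMap between (xs ++ ys) , hull⊆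
    where
    between : O → List O
    between a = concatMap (λ b → proj₁ (lf a b)) (xs ++ ys)
    ∪⊆xs++ys : ∀ c → J c ⊎ K c → c ∈ xs ++ ys
    ∪⊆xs++ys c = [ ∈-++⁺ˡ ∘ J⊆xs c , ∈-++⁺ʳ xs ∘ K⊆ys c ]
    hull⊆ : ∀ y → hull J K y → y ∈ concatMap between (xs ++ ys)
    hull⊆ y (a , b , Ja , Jb , a≤y , y≤b) =
      ∈-concatMap⁺ between (lose (∪⊆xs++ys a Ja)
        (∈-concatMap⁺ _ (lose (∪⊆xs++ys b Jb) (proj₂ (lf a b) y (a≤y , y≤b)))))

  hull-finInterval : LocallyFinite _≤_ → {J K : Subset O} →
    FinInterval _≤_ J → FinInterval _≤_ K → FinInterval _≤_ (hull J K)
  hull-finInterval lf {J} {K} (_ , J-finite) (_ , K-finite) =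
    hull-interval J K , hull-finite lf J-finite K-finite

module _ (em : ∀ {ℓ} → ExcludedMiddle ℓ)
  {O : Set} {_≤_ : O → O → Set} (isPartialOrder : IsPartialOrder _≡_ _≤_) (lf : LocallyFinite _≤_) where

  open IsPartialOrder isPartialOrder using (isPreorder; antisym)
  open Hull isPreorder

  ⊆-or-escapes : (X Y : Subset O) → X ⊆ Y ⊎ Σ O λ y → X y × ¬ Y y
  ⊆-or-escapes X Y with em {P = Σ O λ y → X y × ¬ Y y}
  ... | yes escape = inj₂ escape
  ... | no ¬escape = inj₁ λ y Xy → em⇒dne em λ ¬Yy → ¬escape (y , Xy , ¬Yy)

  ⊆｛｝⇒≐⊎⊆∅ : {X : Subset O} {x : O} → X ⊆ ｛ x ｝ → X ≐ ｛ x ｝ ⊎ X ⊆ ∅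
  ⊆｛｝⇒≐⊎⊆∅ {X} {x} X⊆x with em {P = X x}
  ... | yes Xx = inj₁ (X⊆x , ｛｝-⊆ Xx)
  ... | no ¬Xx = inj₂ λ y Xy → ¬Xx (subst X (sym (X⊆x y Xy)) Xy)

  meet-member-⊆-hull : {A B C : Family} → IsE _≤_ B → IsE _≤_ C → IsMeet _≤_ B C A →
    {J K : Subset O} → B J → C K → Σ (Subset O) λ N → A N × N ⊆ hull J K
  meet-member-⊆-hull (B-fi , _) (C-fi , _) (_ , _ , _ , greatest) {J} {K} BJ CK =
    greatest (singletonFamily (hull J K))
      (singletonFamily-IsE (hull-finInterval lf (B-fi J BJ) (C-fi K CK)))
      (singletonFamily-≤E BJ (⊆-hullˡ J K)) (singletonFamily-≤E CK (⊆-hullʳ J K))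
      (hull J K) ≐-refl

  module _ {A : Family} {I : Subset O} (A≈Ĩ : A ≈E tilde I) where

    member-singleton : {N : Subset O} → A N → Σ O λ x → ¬ I x × N ≐ ｛ x ｝
    member-singleton AN with proj₁ A≈Ĩ _ AN
    ... | _ , (x , ¬Ix , X≐x) , X≐N = x , ¬Ix , ≐-trans (≐-sym X≐N) X≐x

    ≈E-if-no-member-⊆ : {B : Family} → IsE _≤_ B → A ≤E B → (∀ J → B J → ¬ J ⊆ I) → A ≈E B
    ≈E-if-no-member-⊆ {B} (_ , B-antichain) A≤B B⊈I = to , from
      where
      to : ∀ N → A N → Σ (Subset O) λ J → B J × J ≐ N
      to N AN with member-singleton AN | A≤B N AN
      ... | _ , _ , N≐x | J , BJ , J⊆N with ⊆｛｝⇒≐⊎⊆∅ (⊆-trans J⊆N (proj₁ N≐x))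
      ... | inj₁ J≐x = J , BJ , ≐-trans J≐x (≐-sym N≐x)
      ... | inj₂ J⊆∅ = ⊥-elim (B⊈I J BJ (⊆∅ J⊆∅))
      from : ∀ J → B J → Σ (Subset O) λ N → A N × N ≐ J
      from J BJ with ⊆-or-escapes J I
      ... | inj₁ J⊆I = ⊥-elim (B⊈I J BJ J⊆I)
      ... | inj₂ (y , Jy , ¬Iy) with proj₂ A≈Ĩ ｛ y ｝ (y , ¬Iy , ≐-refl)
      ... | N , AN , N≐y with A≤B N AN
      ... | J′ , BJ′ , J′⊆N = N , AN , N⊆J , ⊆-trans (proj₂ J′≐J) J′⊆N
        where
        N⊆J : N ⊆ J
        N⊆J = ⊆-trans (proj₁ N≐y) (｛｝-⊆ Jy)
        J′≐J : J′ ≐ J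
        J′≐J = B-antichain J′ J BJ′ BJ (⊆-trans J′⊆N N⊆J)

    member-⊆ : {B : Family} → IsE _≤_ B → A ≤E B → ¬ A ≈E B → Σ (Subset O) λ J → B J × J ⊆ I
    member-⊆ {B} isEB A≤B A≉B with em {P = Σ (Subset O) λ J → B J × J ⊆ I}
    ... | yes member = member
    ... | no ∄member = ⊥-elim (A≉B (≈E-if-no-member-⊆ isEB A≤B λ J BJ J⊆I → ∄member (J , BJ , J⊆I)))

    tilde-meetIrreducible : Interval _≤_ I → MeetIrreducible _≤_ A
    tilde-meetIrreducible I-interval B C isEB isEC A=B∧C@(_ , A≤B , A≤C , _)
      with em {P = A ≈E B} | em {P = A ≈E C}
    ... | yes A≈B | _ = inj₁ A≈B
    ... | no _ | yes A≈C = inj₂ A≈C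
    ... | no A≉B | no A≉C with member-⊆ isEB A≤B A≉B | member-⊆ isEC A≤C A≉C
    ... | J , BJ , J⊆I | K , CK , K⊆I with meet-member-⊆-hull isEB isEC A=B∧C BJ CK
    ... | N , AN , N⊆hull with member-singleton AN
    ... | x , ¬Ix , N≐x = ⊥-elim (¬Ix (hull-least I-interval J⊆I K⊆I x (N⊆hull x (proj₂ N≐x x refl))))

  Avoids : Family → Subset O → Set₁
  Avoids A X = ∀ N → A N → ¬ N ⊆ X

  Free : Family → Subset O → Set₁
  Free A X = FinInterval _≤_ X × Avoids A X

  adjoin : Family → Subset O → Family
  adjoin A Z X = (A X × ¬ Z ⊆ X) ⊎ X ≐ Z

  module _ {A : Family} (isEA : IsE _≤_ A) where

    adjoin-IsE : {Z : Subset O} → Free A Z → IsE _≤_ (adjoin A Z)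
    adjoin-IsE {Z} (Z-fi , Z-avoids) = fi , antichain
      where
      fi : ∀ X → adjoin A Z X → FinInterval _≤_ X
      fi X (inj₁ (AX , _)) = proj₁ isEA X AX
      fi X (inj₂ X≐Z) = FinInterval-≐ X≐Z Z-fi
      antichain : ∀ X Y → adjoin A Z X → adjoin A Z Y → X ⊆ Y → X ≐ Y
      antichain X Y (inj₁ (AX , _)) (inj₁ (AY , _)) X⊆Y = proj₂ isEA X Y AX AY X⊆Y
      antichain X Y (inj₁ (AX , _)) (inj₂ Y≐Z) X⊆Y = ⊥-elim (Z-avoids X AX (⊆-trans X⊆Y (proj₁ Y≐Z)))
      antichain X Y (inj₂ X≐Z) (inj₁ (_ , Z⊈Y)) X⊆Y = ⊥-elim (Z⊈Y (⊆-trans (proj₂ X≐Z) X⊆Y))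
      antichain X Y (inj₂ X≐Z) (inj₂ Y≐Z) _ = ≐-trans X≐Z (≐-sym Y≐Z)

    ≤E-adjoin : {Z : Subset O} → A ≤E adjoin A Z
    ≤E-adjoin {Z} N AN with em {P = Z ⊆ N}
    ... | yes Z⊆N = Z , inj₂ ≐-refl , Z⊆N
    ... | no Z⊈N = N , inj₁ (AN , Z⊈N) , ⊆-refl

    adjoin-≉E : {Z : Subset O} → Avoids A Z → ¬ A ≈E adjoin A Z
    adjoin-≉E Z-avoids (_ , adjoin⊆A) with adjoin⊆A _ (inj₂ ≐-refl)
    ... | N , AN , N≐Z = Z-avoids N AN (proj₁ N≐Z)

    -- A member of D lying above both J and K contains hull J K, hence N.
    adjoin-greatest : {J K N : Subset O} → A N → N ⊆ hull J K →
      ∀ D → IsE _≤_ D → D ≤E adjoin A J → D ≤E adjoin A K → D ≤E A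
    adjoin-greatest {J} {K} {N} AN N⊆hull D (D-fi , _) D≤J D≤K X DX with D≤J X DX | D≤K X DX
    ... | P , inj₁ (AP , _) , P⊆X | _ = P , AP , P⊆X
    ... | _ , inj₂ _ , _ | Q , inj₁ (AQ , _) , Q⊆X = Q , AQ , Q⊆X
    ... | P , inj₂ P≐J , P⊆X | Q , inj₂ Q≐K , Q⊆X =
      N , AN , ⊆-trans N⊆hull
        (hull-least (proj₁ (D-fi X DX)) (⊆-trans (proj₂ P≐J) P⊆X) (⊆-trans (proj₂ Q≐K) Q⊆X))

    hull-free : MeetIrreducible _≤_ A → {J K : Subset O} → Free A J → Free A K → Free A (hull J K)
    hull-free irreducible {J} {K} J-free@(J-fi , J-avoids) K-free@(K-fi , K-avoids) =
      hull-finInterval lf J-fi K-fi , hull-avoids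
      where
      hull-avoids : Avoids A (hull J K)
      hull-avoids N AN N⊆hull
        with irreducible (adjoin A J) (adjoin A K) (adjoin-IsE J-free) (adjoin-IsE K-free)
               (isEA , ≤E-adjoin , ≤E-adjoin , adjoin-greatest AN N⊆hull)
      ... | inj₁ A≈J = adjoin-≉E J-avoids A≈J
      ... | inj₂ A≈K = adjoin-≉E K-avoids A≈K

    ∅-free : ¬ A ≈E 𝟙 → Free A ∅
    ∅-free A≉𝟙 = ∅-finInterval , λ N AN N⊆∅ → A≉𝟙 (∅∈⇒≈𝟙 isEA AN N⊆∅)

    InFree : O → Set₁
    InFree x = Σ (Subset O) λ X → Free A X × X x

    -- InFree x lives in Set₁; deciding it with excluded middle squashes it into Set.
    ⋃Free : Subset O
    ⋃Free x = True (em {P = InFree x})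

    ⋃Free⁻ : {x : O} → ⋃Free x → InFree x
    ⋃Free⁻ {x} = toWitness {a? = em {P = InFree x}}

    ⋃Free⁺ : {x : O} → InFree x → ⋃Free x
    ⋃Free⁺ {x} = fromWitness {a? = em {P = InFree x}}

    module _ (irreducible : MeetIrreducible _≤_ A) (A≉𝟙 : ¬ A ≈E 𝟙) where

      ⋃Free-interval : Interval _≤_ ⋃Free
      ⋃Free-interval x y z ⋃x ⋃z x≤y y≤z with ⋃Free⁻ ⋃x | ⋃Free⁻ ⋃z
      ... | X , X-free , Xx | Z , Z-free , Zz =
        ⋃Free⁺ (hull X Z , hull-free irreducible X-free Z-free , x , z , inj₁ Xx , inj₂ Zz , x≤y , y≤z)

      free-cover : (N : Subset O) (xs : List O) → (∀ x → x ∈ xs → N x → ⋃Free x) →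
        Σ (Subset O) λ X → Free A X × (∀ x → x ∈ xs → N x → X x)
      free-cover N [] _ = ∅ , ∅-free A≉𝟙 , λ _ ()
      free-cover N (x ∷ xs) ⊆⋃Free with free-cover N xs (λ y y∈xs → ⊆⋃Free y (there y∈xs)) | em {P = N x}
      ... | X , X-free , covers | no ¬Nx = X , X-free , covers′
        where
        covers′ : ∀ y → y ∈ x ∷ xs → N y → X y
        covers′ y (here refl) Nx = ⊥-elim (¬Nx Nx)
        covers′ y (there y∈xs) Ny = covers y y∈xs Ny
      ... | X , X-free , covers | yes Nx with ⋃Free⁻ (⊆⋃Free x (here refl) Nx)
      ... | Y , Y-free , Yx = hull X Y , hull-free irreducible X-free Y-free , covers′
        where
        covers′ : ∀ y → y ∈ x ∷ xs → N y → hull X Y y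
        covers′ y (here refl) _ = ⊆-hullʳ X Y y Yx
        covers′ y (there y∈xs) Ny = ⊆-hullˡ X Y y (covers y y∈xs Ny)

      ∉⋃Free⇒｛｝∈ : {x : O} → ¬ ⋃Free x → Σ (Subset O) λ N → A N × N ≐ ｛ x ｝
      ∉⋃Free⇒｛｝∈ {x} x∉⋃ with em {P = Σ (Subset O) λ N → A N × N ⊆ ｛ x ｝}
      ... | no ∄N = ⊥-elim (x∉⋃ (⋃Free⁺ (｛ x ｝ , x-free , refl)))
        where
        x-free : Free A ｛ x ｝
        x-free = ｛｝-finInterval antisym x , λ N AN N⊆x → ∄N (N , AN , N⊆x)
      ... | yes (N , AN , N⊆x) with ⊆｛｝⇒≐⊎⊆∅ N⊆x
      ... | inj₁ N≐x = N , AN , N≐x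
      ... | inj₂ N⊆∅ = ⊥-elim (A≉𝟙 (∅∈⇒≈𝟙 isEA AN N⊆∅))

      ≈E-tilde⋃Free : A ≈E tilde ⋃Free
      ≈E-tilde⋃Free = to , from
        where
        to : ∀ N → A N → Σ (Subset O) λ X → tilde ⋃Free X × X ≐ N
        to N AN with ⊆-or-escapes N ⋃Free
        ... | inj₁ N⊆⋃ with proj₂ (proj₁ isEA N AN)
        ... | xs , N⊆xs with free-cover N xs (λ x _ → N⊆⋃ x)
        ... | X , (_ , X-avoids) , covers = ⊥-elim (X-avoids N AN λ x Nx → covers x (N⊆xs x Nx) Nx)
        to N AN | inj₂ (y , Ny , y∉⋃) with ∉⋃Free⇒｛｝∈ y∉⋃
        ... | N′ , AN′ , N′≐y = ｛ y ｝ , (y , y∉⋃ , ≐-refl) , ｛｝-⊆ Ny , ⊆-trans (proj₂ N′≐N) (proj₁ N′≐y)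
          where
          N′≐N : N′ ≐ N
          N′≐N = proj₂ isEA N′ N AN′ AN (⊆-trans (proj₁ N′≐y) (｛｝-⊆ Ny))
        from : ∀ J → tilde ⋃Free J → Σ (Subset O) λ N → A N × N ≐ J
        from J (x , x∉⋃ , J≐x) with ∉⋃Free⇒｛｝∈ x∉⋃
        ... | N , AN , N≐x = N , AN , ≐-trans N≐x (≐-sym J≐x)

proposition13 : (em : ∀ {ℓ} → ExcludedMiddle ℓ)
    → (O : Set) (_≤_ : O → O → Set) → IsTotalOrder _≡_ _≤_ → LocallyFinite _≤_
    → (A : Family {O}) → IsE _≤_ A → ¬ (A ≈E 𝟙)
    → MeetIrreducible _≤_ A ⇔ Σ (Subset O) (λ I → Interval _≤_ I × (A ≈E tilde I))
proposition13 em O _≤_ isTotalOrder lf A isEA A≉𝟙 = mk⇔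
  (λ irreducible →
    ⋃Free em isPartialOrder lf isEA ,
    ⋃Free-interval em isPartialOrder lf isEA irreducible A≉𝟙 ,
    ≈E-tilde⋃Free em isPartialOrder lf isEA irreducible A≉𝟙)
  (λ { (I , I-interval , A≈Ĩ) → tilde-meetIrreducible em isPartialOrder lf A≈Ĩ I-interval })
  where
  open IsTotalOrder isTotalOrder using (isPartialOrder)
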